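{- Let $p>3$ be a prime, $r\in\mathbb{Z}^+$ and $q=p^r$. For every integer $l$ with $1\leq l\leq q-2$ and $l\neq \frac{q-1}{2}$, and every integer $i$ with $0\leq i\leq r-1$, \[ \Big\lfloor\frac{3lp^i}{q-1}\Big\rfloor+3\Big\lfloor\frac{ -lp^i}{q-1}\Big\rfloor- 3\Big\lfloor\frac{ -2lp^i}{q-1}\Big\rfloor-\Big\lfloor\frac{6lp^i}{q-1}\Big\rfloor =-2\Big\lfloor\Big\langle \frac{p^i}{2}\Big\rangle- \frac{lp^i}{q-1}\Big\rfloor -\Big\lfloor\Big\langle \frac{ -p^i}{6} \Big\rangle+ \frac{lp^i}{q-1}\Big\rfloor-\Big\lfloor\Big\langle \frac{ -5p^i}{6} \Big\rangle+\frac{lp^i}{q-1}\Big\rfloor. \]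
   Context: For $x\in\mathbb{Q}$, $\lfloor x\rfloor$ denotes the greatest integer $\le x$ and $\langle x\rangle=x-\lfloor x\rfloor$ the fractional part. -}

module Defs where

open import Data.Nat as ℕ using (ℕ; zero; suc)
open import Data.Integer as ℤ using (ℤ)
open import Data.Rational as ℚ using (ℚ; floor; _/_)

-- the rational number n / d ; only ever used with d ≠ 0 (convention: n / 0 := 0)
_//_ : ℤ → ℕ → ℚ
n // zero = ℚ.0ℚ
n // suc d = n / suc d

-- the fractional part ⟨x⟩ = x - ⌊x⌋ (note: stdlib's fracPart uses truncation, so we define it)
⟨_⟩ : ℚ → ℚ
⟨ x ⟩ = x ℚ.- (floor x / 1)

-- Write t = l p^i / (q − 1), J = ⌊6t⌋ and J′ = ⌊−6t⌋, so that J′ = −J when 6t is an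
-- integer and J′ = −J − 1 otherwise. Since ⌊⌊x⌋ / m⌋ = ⌊x / m⌋, every floor on the left
-- is ⌊J / k⌋ or ⌊J′ / k⌋ with k ∣ 6. As p^i is prime to 6, ⟨p^i/2⟩ = 1/2 and
-- {⟨−p^i/6⟩, ⟨−5p^i/6⟩} = {1/6, 5/6}, so the floors on the right are ⌊(J′ + 3) / 6⌋,
-- ⌊(J + 1) / 6⌋ and ⌊(J + 5) / 6⌋. Both sides are invariant under (J, J′) ↦ (J + 6, J′ − 6),
-- and checking the six residues of J shows that the identity holds except when J′ = −J and
-- J ≡ 3 (mod 6). That case means 2t is an odd integer, hence q − 1 ∣ 2l p^i, hence
-- q − 1 ∣ 2l as q − 1 is prime to p, hence 2l = q − 1, which is excluded.
module Submission where

open import Defs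
open import Data.Nat as ℕ using (ℕ; _^_; _∸_; _<_; _≤_)
open import Data.Nat.Primality using (Prime)
open import Data.Integer as ℤ using (ℤ; +_)
open import Data.Rational as ℚ using (ℚ; floor; _/_)
open import Relation.Binary.PropositionalEquality using (_≡_; _≢_)

open import Data.Nat using (zero; suc; s≤s; z≤n)
open import Data.Integer using (-[1+_]; _+_; _-_; _*_; -_; _%_)
import Data.Nat.Properties as ℕP
open import Data.Nat.DivMod using (m≡m%n+[m/n]*n; m%n<n)
open import Data.Nat.Divisibility using (_∣_; divides; ∣1⇒≡1; ∣m+n∣m⇒∣n; ∣-trans)
open import Data.Nat.Coprimality using (Coprime; coprime-divisor)
open import Data.Nat.Primality using (prime?; prime[2]; euclidsLemma; prime⇒irreducible; ¬prime[1])
import Data.Nat.Tactic.RingSolver as ℕ-Ring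
import Data.Integer.Properties as ℤP
open import Data.Integer.DivMod using (a≡a%n+[a/n]*n; n%d<d; [n/d]*d≤n; n<s[n/ℕd]*d; div-pos-is-/ℕ)
open import Data.Integer.Tactic.RingSolver using (solve-∀)
open import Data.Rational using (mkℚ; toℚᵘ)
import Data.Rational.Properties as ℚP
open import Data.Rational.Unnormalised as ℚᵘ using (mkℚᵘ; *≡*) renaming (_≃_ to _≃ᵘ_)
import Data.Rational.Unnormalised.Properties as ℚᵘP
open import Data.Product using (∃-syntax; _,_)
open import Data.Sum using (_⊎_; inj₁; inj₂)
open import Data.Empty using (⊥-elim)
open import Data.Unit using (tt)
open import Relation.Nullary using (¬_; contradiction)
open import Relation.Nullary.Decidable using (toWitness)
open import Relation.Binary.PropositionalEquality
  using (refl; sym; trans; cong; cong₂; subst; module ≡-Reasoning)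

-- Floor division of integers by positive integers

<-suc⇒≤ : ∀ {i j} → i ℤ.< ℤ.suc j → i ℤ.≤ j
<-suc⇒≤ {i} {j} i<1+j = subst (i ℤ.≤_) (pred-suc j) (ℤP.i<j⇒i≤pred[j] i<1+j)
  where
  pred-suc : ∀ j → -[1+ 0 ] + (+ 1 + j) ≡ j
  pred-suc = solve-∀

module _ {d : ℕ} where

  n<suc[n/d]*d : ∀ n → n ℤ.< ℤ.suc (n ℤ./ + suc d) * + suc d
  n<suc[n/d]*d n = subst (λ k → n ℤ.< ℤ.suc k * + suc d) (sym (div-pos-is-/ℕ n (suc d)))
                         (n<s[n/ℕd]*d n (suc d))

  /-unique : ∀ {n k} → k * + suc d ℤ.≤ n → n ℤ.< ℤ.suc k * + suc d → n ℤ./ + suc d ≡ k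
  /-unique {n} lo hi = ℤP.≤-antisym
    (<-suc⇒≤ (ℤP.*-cancelʳ-<-nonNeg (+ suc d) (ℤP.≤-<-trans ([n/d]*d≤n n (+ suc d)) hi)))
    (<-suc⇒≤ (ℤP.*-cancelʳ-<-nonNeg (+ suc d) (ℤP.≤-<-trans lo (n<suc[n/d]*d n))))

  [n+k*d]/d≡n/d+k : ∀ n k → (n + k * + suc d) ℤ./ + suc d ≡ n ℤ./ + suc d + k
  [n+k*d]/d≡n/d+k n k = /-unique lo hi
    where
    open ℤP.≤-Reasoning
    q : ℤ
    q = n ℤ./ + suc d
    lo : (q + k) * + suc d ℤ.≤ n + k * + suc d
    lo = begin
      (q + k) * + suc d          ≡⟨ ℤP.*-distribʳ-+ (+ suc d) q k ⟩
      q * + suc d + k * + suc d  ≤⟨ ℤP.+-monoˡ-≤ (k * + suc d) ([n/d]*d≤n n (+ suc d)) ⟩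
      n + k * + suc d            ∎
    hi : n + k * + suc d ℤ.< ℤ.suc (q + k) * + suc d
    hi = begin-strict
      n + k * + suc d                    <⟨ ℤP.+-monoˡ-< (k * + suc d) (n<suc[n/d]*d n) ⟩
      ℤ.suc q * + suc d + k * + suc d    ≡⟨ ℤP.*-distribʳ-+ (+ suc d) (ℤ.suc q) k ⟨
      (ℤ.suc q + k) * + suc d            ≡⟨ cong (_* + suc d) (ℤP.+-assoc (+ 1) q k) ⟩
      ℤ.suc (q + k) * + suc d            ∎

  /-shift : ∀ {n′} n k → n′ ≡ n + k * + suc d → n′ ℤ./ + suc d ≡ n ℤ./ + suc d + k
  /-shift n k refl = [n+k*d]/d≡n/d+k n k

  r/d≡0 : ∀ {r} → r ℕ.< suc d → + r ℤ./ + suc d ≡ + 0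
  r/d≡0 {r} r<d = /-unique (ℤ.+≤+ z≤n) (subst (+ r ℤ.<_) (sym (ℤP.*-identityˡ (+ suc d))) (ℤ.+<+ r<d))

  -[1+r]/d≡-1 : ∀ {r} → r ℕ.< suc d → -[1+ r ] ℤ./ + suc d ≡ -[1+ 0 ]
  -[1+r]/d≡-1 {r} r<d = /-unique (subst (ℤ._≤ -[1+ r ]) (sym (ℤP.-1*i≡-i (+ suc d))) (ℤ.-≤- (ℕP.≤-pred r<d))) ℤ.-<+

  %-unique : ∀ {n r} k → n ≡ + r + k * + suc d → r ℕ.< suc d → n % + suc d ≡ r
  %-unique {n} {r} k n≡r+k*d r<d = ℤP.+-injective (begin
    + (n % + suc d)                                      ≡⟨ x+y-y≡x (+ (n % + suc d)) (q * + suc d) ⟨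
    + (n % + suc d) + q * + suc d - q * + suc d          ≡⟨ cong₂ (λ a b → a - b * + suc d) (sym (a≡a%n+[a/n]*n n (+ suc d))) q≡k ⟩
    n - k * + suc d                                      ≡⟨ cong (λ a → a - k * + suc d) n≡r+k*d ⟩
    + r + k * + suc d - k * + suc d                      ≡⟨ x+y-y≡x (+ r) (k * + suc d) ⟩
    + r                                                  ∎)
    where
    open ≡-Reasoning
    q : ℤ
    q = n ℤ./ + suc d
    q≡k : q ≡ k
    q≡k = trans (/-shift (+ r) k n≡r+k*d) (trans (cong (_+ k) (r/d≡0 r<d)) (ℤP.+-identityˡ k))
    x+y-y≡x : ∀ x y → x + y - y ≡ x
    x+y-y≡x = solve-∀

/-cong : ∀ {d d′} n n′ → n * + suc d′ ≡ n′ * + suc d → n′ ℤ./ + suc d′ ≡ n ℤ./ + suc d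
/-cong {d} {d′} n n′ eq = /-unique lo hi
  where
  open ℤP.≤-Reasoning
  k : ℤ
  k = n ℤ./ + suc d
  swap : ∀ a b c → a * b * c ≡ a * c * b
  swap = solve-∀
  lo : k * + suc d′ ℤ.≤ n′
  lo = ℤP.*-cancelʳ-≤-pos _ _ (+ suc d) (begin
    k * + suc d′ * + suc d  ≡⟨ swap k (+ suc d′) (+ suc d) ⟩
    k * + suc d * + suc d′  ≤⟨ ℤP.*-monoʳ-≤-nonNeg (+ suc d′) ([n/d]*d≤n n (+ suc d)) ⟩
    n * + suc d′            ≡⟨ eq ⟩
    n′ * + suc d            ∎)
  hi : n′ ℤ.< ℤ.suc k * + suc d′
  hi = ℤP.*-cancelʳ-<-nonNeg (+ suc d) (begin-strict
    n′ * + suc d                  ≡⟨ eq ⟨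
    n * + suc d′                  <⟨ ℤP.*-monoʳ-<-pos (+ suc d′) (n<suc[n/d]*d n) ⟩
    ℤ.suc k * + suc d * + suc d′  ≡⟨ swap (ℤ.suc k) (+ suc d) (+ suc d′) ⟩
    ℤ.suc k * + suc d′ * + suc d  ∎)

n/[c*b]≡n/b/c : ∀ {b c} n → n ℤ./ + (suc c ℕ.* suc b) ≡ (n ℤ./ + suc b) ℤ./ + suc c
n/[c*b]≡n/b/c {b} {c} n = /-unique lo hi
  where
  open ℤP.≤-Reasoning
  q : ℤ
  q = n ℤ./ + suc b
  u : ℤ
  u = q ℤ./ + suc c
  c*b≡c*b : + (suc c ℕ.* suc b) ≡ + suc c * + suc b
  c*b≡c*b = ℤP.pos-* (suc c) (suc b)
  lo : u * + (suc c ℕ.* suc b) ℤ.≤ n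
  lo = begin
    u * + (suc c ℕ.* suc b)   ≡⟨ cong (u *_) c*b≡c*b ⟩
    u * (+ suc c * + suc b)   ≡⟨ ℤP.*-assoc u (+ suc c) (+ suc b) ⟨
    u * + suc c * + suc b     ≤⟨ ℤP.*-monoʳ-≤-nonNeg (+ suc b) ([n/d]*d≤n q (+ suc c)) ⟩
    q * + suc b               ≤⟨ [n/d]*d≤n n (+ suc b) ⟩
    n                         ∎
  hi : n ℤ.< ℤ.suc u * + (suc c ℕ.* suc b)
  hi = begin-strict
    n                               <⟨ n<suc[n/d]*d n ⟩
    ℤ.suc q * + suc b               ≤⟨ ℤP.*-monoʳ-≤-nonNeg (+ suc b) (ℤP.i<j⇒suc[i]≤j (n<suc[n/d]*d q)) ⟩
    ℤ.suc u * + suc c * + suc b     ≡⟨ ℤP.*-assoc (ℤ.suc u) (+ suc c) (+ suc b) ⟩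
    ℤ.suc u * (+ suc c * + suc b)   ≡⟨ cong (ℤ.suc u *_) c*b≡c*b ⟨
    ℤ.suc u * + (suc c ℕ.* suc b)   ∎

/-scale : ∀ {d} m {n n′} → + suc m * n ≡ n′ → n ℤ./ + suc d ≡ (n′ ℤ./ + suc d) ℤ./ + suc m
/-scale {d} m {n} {n′} m*n≡n′ = trans (/-cong n′ n cross) (n/[c*b]≡n/b/c n′)
  where
  open ≡-Reasoning
  rearrange : ∀ a b c → a * b * c ≡ b * (a * c)
  rearrange = solve-∀
  cross : n′ * + suc d ≡ n * + (suc m ℕ.* suc d)
  cross = begin
    n′ * + suc d               ≡⟨ cong (_* + suc d) m*n≡n′ ⟨
    + suc m * n * + suc d      ≡⟨ rearrange (+ suc m) n (+ suc d) ⟩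
    n * (+ suc m * + suc d)    ≡⟨ cong (n *_) (ℤP.pos-* (suc m) (suc d)) ⟨
    n * + (suc m ℕ.* suc d)    ∎

floor≡floorᵘ∘toℚᵘ : ∀ x → floor x ≡ ℚᵘ.floor (toℚᵘ x)
floor≡floorᵘ∘toℚᵘ (mkℚ _ _ _) = refl

floorᵘ-cong : ∀ {p q} → p ≃ᵘ q → ℚᵘ.floor p ≡ ℚᵘ.floor q
floorᵘ-cong {mkℚᵘ n d} {mkℚᵘ n′ d′} (*≡* eq) = sym (/-cong n n′ eq)

toℚᵘ-/ : ∀ n d → toℚᵘ (n / suc d) ≃ᵘ mkℚᵘ n d
toℚᵘ-/ n d = ℚP.toℚᵘ-fromℚᵘ (mkℚᵘ n d)

floor-/ : ∀ n d → floor (n / suc d) ≡ n ℤ./ + suc d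
floor-/ n d = trans (floor≡floorᵘ∘toℚᵘ (n / suc d)) (floorᵘ-cong (toℚᵘ-/ n d))

module _ (n : ℤ) (d : ℕ) where

  toℚᵘ-⟨n/d⟩ : toℚᵘ ⟨ n / suc d ⟩ ≃ᵘ mkℚᵘ (+ (n % + suc d)) d
  toℚᵘ-⟨n/d⟩ = begin
    toℚᵘ ⟨ n / suc d ⟩
      ≈⟨ ℚP.toℚᵘ-homo-+ (n / suc d) (ℚ.- (floor (n / suc d) / 1)) ⟩
    toℚᵘ (n / suc d) ℚᵘ.+ toℚᵘ (ℚ.- (floor (n / suc d) / 1))
      ≈⟨ ℚᵘP.+-cong (toℚᵘ-/ n d) (ℚᵘP.≃-trans (ℚP.toℚᵘ-homo‿- (floor (n / suc d) / 1))
                                              (ℚᵘP.-‿cong (toℚᵘ-/ (floor (n / suc d)) 0))) ⟩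
    mkℚᵘ n d ℚᵘ.- mkℚᵘ (floor (n / suc d)) 0
      ≡⟨ cong (λ f → mkℚᵘ n d ℚᵘ.- mkℚᵘ f 0) (floor-/ n d) ⟩
    mkℚᵘ n d ℚᵘ.- mkℚᵘ q 0
      ≈⟨ *≡* cross ⟩
    mkℚᵘ (+ r) d ∎
    where
    open ℚᵘP.≃-Reasoning
    q : ℤ
    q = n ℤ./ + suc d
    r : ℕ
    r = n % + suc d
    cancel : ∀ r k D → (r + k * D) * + 1 + - k * D ≡ r
    cancel = solve-∀
    cross : (n * + 1 + - q * + suc d) * + suc d ≡ + r * + (suc d ℕ.* 1)
    cross = cong₂ _*_
      (trans (cong (λ m → m * + 1 + - q * + suc d) (a≡a%n+[a/n]*n n (+ suc d))) (cancel (+ r) q (+ suc d)))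
      (cong +_ (sym (ℕP.*-identityʳ (suc d))))

  floor[⟨n/d⟩-z/m] : ∀ z m → floor (⟨ n / suc d ⟩ ℚ.- z / suc m)
                     ≡ (+ (n % + suc d) * + suc m + - z * + suc d) ℤ./ + (suc d ℕ.* suc m)
  floor[⟨n/d⟩-z/m] z m = trans (floor≡floorᵘ∘toℚᵘ (⟨ n / suc d ⟩ ℚ.- z / suc m)) (floorᵘ-cong (ℚᵘP.≃-trans
    (ℚP.toℚᵘ-homo-+ ⟨ n / suc d ⟩ (ℚ.- (z / suc m)))
    (ℚᵘP.+-cong toℚᵘ-⟨n/d⟩ (ℚᵘP.≃-trans (ℚP.toℚᵘ-homo‿- (z / suc m)) (ℚᵘP.-‿cong (toℚᵘ-/ z m))))))

  floor[⟨n/d⟩+z/m] : ∀ z m → floor (⟨ n / suc d ⟩ ℚ.+ z / suc m)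
                     ≡ (+ (n % + suc d) * + suc m + z * + suc d) ℤ./ + (suc d ℕ.* suc m)
  floor[⟨n/d⟩+z/m] z m = trans (floor≡floorᵘ∘toℚᵘ (⟨ n / suc d ⟩ ℚ.+ z / suc m)) (floorᵘ-cong (ℚᵘP.≃-trans
    (ℚP.toℚᵘ-homo-+ ⟨ n / suc d ⟩ (z / suc m)) (ℚᵘP.+-cong toℚᵘ-⟨n/d⟩ (toℚᵘ-/ z m))))

-- The identity in terms of J = ⌊6t⌋ and J′ = ⌊−6t⌋

lhsᴶ : ℤ → ℤ → ℤ
lhsᴶ J J′ = J ℤ./ + 2 + + 3 * (J′ ℤ./ + 6) - + 3 * (J′ ℤ./ + 3) - J

rhsᴶ : ℤ → ℤ → ℕ → ℕ → ℤ
rhsᴶ J J′ c₁ c₂ = - + 2 * ((J′ + + 3) ℤ./ + 6) - (J + + c₁) ℤ./ + 6 - (J + + c₂) ℤ./ + 6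

rhsᴶ-swap : ∀ J J′ c₁ c₂ → rhsᴶ J J′ c₁ c₂ ≡ rhsᴶ J J′ c₂ c₁
rhsᴶ-swap J J′ c₁ c₂ = swap (- + 2 * ((J′ + + 3) ℤ./ + 6)) ((J + + c₁) ℤ./ + 6) ((J + + c₂) ℤ./ + 6)
  where
  swap : ∀ a b c → a - b - c ≡ a - c - b
  swap = solve-∀

lhsᴶ-periodic : ∀ J J′ u → lhsᴶ (J + u * + 6) (J′ - u * + 6) ≡ lhsᴶ J J′
lhsᴶ-periodic J J′ u = begin
  lhsᴶ (J + u * + 6) (J′ - u * + 6)
    ≡⟨ cong₂ (λ x y → x + + 3 * y - + 3 * ((J′ - u * + 6) ℤ./ + 3) - (J + u * + 6))
             (/-shift J (u * + 3) (e₁ J u)) (/-shift J′ (- u) (e₂ J′ u)) ⟩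
  (J ℤ./ + 2 + u * + 3) + + 3 * (J′ ℤ./ + 6 + - u) - + 3 * ((J′ - u * + 6) ℤ./ + 3) - (J + u * + 6)
    ≡⟨ cong (λ z → (J ℤ./ + 2 + u * + 3) + + 3 * (J′ ℤ./ + 6 + - u) - + 3 * z - (J + u * + 6))
            (/-shift J′ (- u * + 2) (e₃ J′ u)) ⟩
  (J ℤ./ + 2 + u * + 3) + + 3 * (J′ ℤ./ + 6 + - u) - + 3 * (J′ ℤ./ + 3 + - u * + 2) - (J + u * + 6)
    ≡⟨ cancel (J ℤ./ + 2) (J′ ℤ./ + 6) (J′ ℤ./ + 3) J u ⟩
  lhsᴶ J J′ ∎
  where
  open ≡-Reasoning
  e₁ : ∀ J u → J + u * + 6 ≡ J + (u * + 3) * + 2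
  e₁ = solve-∀
  e₂ : ∀ J′ u → J′ - u * + 6 ≡ J′ + - u * + 6
  e₂ = solve-∀
  e₃ : ∀ J′ u → J′ - u * + 6 ≡ J′ + (- u * + 2) * + 3
  e₃ = solve-∀
  cancel : ∀ a b c J u → (a + u * + 3) + + 3 * (b + - u) - + 3 * (c + - u * + 2) - (J + u * + 6)
                         ≡ a + + 3 * b - + 3 * c - J
  cancel = solve-∀

rhsᴶ-periodic : ∀ J J′ c₁ c₂ u → rhsᴶ (J + u * + 6) (J′ - u * + 6) c₁ c₂ ≡ rhsᴶ J J′ c₁ c₂
rhsᴶ-periodic J J′ c₁ c₂ u = begin
  rhsᴶ (J + u * + 6) (J′ - u * + 6) c₁ c₂
    ≡⟨ cong₂ (λ x y → - + 2 * x - y - (J + u * + 6 + + c₂) ℤ./ + 6)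
             (/-shift (J′ + + 3) (- u) (e₁ J′ u)) (/-shift (J + + c₁) u (e₂ J u (+ c₁))) ⟩
  - + 2 * ((J′ + + 3) ℤ./ + 6 + - u) - ((J + + c₁) ℤ./ + 6 + u) - (J + u * + 6 + + c₂) ℤ./ + 6
    ≡⟨ cong (λ z → - + 2 * ((J′ + + 3) ℤ./ + 6 + - u) - ((J + + c₁) ℤ./ + 6 + u) - z)
            (/-shift (J + + c₂) u (e₂ J u (+ c₂))) ⟩
  - + 2 * ((J′ + + 3) ℤ./ + 6 + - u) - ((J + + c₁) ℤ./ + 6 + u) - ((J + + c₂) ℤ./ + 6 + u)
    ≡⟨ cancel ((J′ + + 3) ℤ./ + 6) ((J + + c₁) ℤ./ + 6) ((J + + c₂) ℤ./ + 6) u ⟩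
  rhsᴶ J J′ c₁ c₂ ∎
  where
  open ≡-Reasoning
  e₁ : ∀ J′ u → J′ - u * + 6 + + 3 ≡ (J′ + + 3) + - u * + 6
  e₁ = solve-∀
  e₂ : ∀ J u c → J + u * + 6 + c ≡ (J + c) + u * + 6
  e₂ = solve-∀
  cancel : ∀ a b c u → - + 2 * (a + - u) - (b + u) - (c + u) ≡ - + 2 * a - b - c
  cancel = solve-∀

lhsᴶ≡rhsᴶ-mod-6 : ∀ J ε → let r = + (J % + 6) in lhsᴶ r (- r + ε) ≡ rhsᴶ r (- r + ε) 1 5 →
                  lhsᴶ J (- J + ε) ≡ rhsᴶ J (- J + ε) 1 5
lhsᴶ≡rhsᴶ-mod-6 J ε base = begin
  lhsᴶ J (- J + ε)                                 ≡⟨ cong₂ lhsᴶ J≡r+u*6 J′≡r′-u*6 ⟩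
  lhsᴶ (r + u * + 6) ((- r + ε) - u * + 6)         ≡⟨ lhsᴶ-periodic r (- r + ε) u ⟩
  lhsᴶ r (- r + ε)                                 ≡⟨ base ⟩
  rhsᴶ r (- r + ε) 1 5                             ≡⟨ rhsᴶ-periodic r (- r + ε) 1 5 u ⟨
  rhsᴶ (r + u * + 6) ((- r + ε) - u * + 6) 1 5     ≡⟨ cong₂ (λ x y → rhsᴶ x y 1 5) J≡r+u*6 J′≡r′-u*6 ⟨
  rhsᴶ J (- J + ε) 1 5                             ∎
  where
  open ≡-Reasoning
  r : ℤ
  r = + (J % + 6)
  u : ℤ
  u = J ℤ./ + 6
  J≡r+u*6 : J ≡ r + u * + 6
  J≡r+u*6 = a≡a%n+[a/n]*n J (+ 6)
  negate : ∀ r u ε → - (r + u * + 6) + ε ≡ (- r + ε) - u * + 6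
  negate = solve-∀
  J′≡r′-u*6 : - J + ε ≡ (- r + ε) - u * + 6
  J′≡r′-u*6 = trans (cong (λ j → - j + ε) J≡r+u*6) (negate r u ε)

lhsᴶ≡rhsᴶ-inexact : ∀ J → lhsᴶ J (- J + -[1+ 0 ]) ≡ rhsᴶ J (- J + -[1+ 0 ]) 1 5
lhsᴶ≡rhsᴶ-inexact J = lhsᴶ≡rhsᴶ-mod-6 J -[1+ 0 ] (base (n%d<d J (+ 6)))
  where
  base : ∀ {v} → v ℕ.< 6 → lhsᴶ (+ v) (- + v + -[1+ 0 ]) ≡ rhsᴶ (+ v) (- + v + -[1+ 0 ]) 1 5
  base {0} _ = refl
  base {1} _ = refl
  base {2} _ = refl
  base {3} _ = refl
  base {4} _ = refl
  base {5} _ = refl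
  base {suc (suc (suc (suc (suc (suc _)))))} (s≤s (s≤s (s≤s (s≤s (s≤s (s≤s ()))))))

lhsᴶ≡rhsᴶ-exact : ∀ J → J % + 6 ≢ 3 → lhsᴶ J (- J + + 0) ≡ rhsᴶ J (- J + + 0) 1 5
lhsᴶ≡rhsᴶ-exact J J≢3 = lhsᴶ≡rhsᴶ-mod-6 J (+ 0) (base (n%d<d J (+ 6)) J≢3)
  where
  base : ∀ {v} → v ℕ.< 6 → v ≢ 3 → lhsᴶ (+ v) (- + v + + 0) ≡ rhsᴶ (+ v) (- + v + + 0) 1 5
  base {0} _ _ = refl
  base {1} _ _ = refl
  base {2} _ _ = refl
  base {3} _ v≢3 = contradiction refl v≢3
  base {4} _ _ = refl
  base {5} _ _ = refl
  base {suc (suc (suc (suc (suc (suc _)))))} (s≤s (s≤s (s≤s (s≤s (s≤s (s≤s ())))))) _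

-- With N = M + 1 and 6A = J N + s, 0 ≤ s < N, the hypothesis on J′ says J′ = ⌊−6A / N⌋.
lhsᴶ≡rhsᴶ : ∀ {M} J J′ s → s ℕ.< suc M → J′ ≡ - J + (- + s) ℤ./ + suc M →
            (s ≡ 0 → J % + 6 ≢ 3) → lhsᴶ J J′ ≡ rhsᴶ J J′ 1 5
lhsᴶ≡rhsᴶ J J′ zero s<N J′≡ J≢3 =
  subst (λ j → lhsᴶ J j ≡ rhsᴶ J j 1 5) (sym (trans J′≡ (cong (λ e → - J + e) (r/d≡0 s<N))))
        (lhsᴶ≡rhsᴶ-exact J (J≢3 refl))
lhsᴶ≡rhsᴶ J J′ (suc s) s<N J′≡ _ =
  subst (λ j → lhsᴶ J j ≡ rhsᴶ J j 1 5) (sym (trans J′≡ (cong (λ e → - J + e) (-[1+r]/d≡-1 (ℕP.<⇒≤ s<N)))))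
        (lhsᴶ≡rhsᴶ-inexact J)

-- The two sides of the identity, with M + 1 = q − 1, A = l p^i and P = p^i.
lhs : ℕ → ℤ → ℤ
lhs M A = floor ((+ 3 * A) / suc M) + + 3 * floor ((- A) / suc M)
          - + 3 * floor ((- (+ 2) * A) / suc M) - floor ((+ 6 * A) / suc M)

rhs : ℕ → ℤ → ℕ → ℤ
rhs M A P = - (+ 2) * floor (⟨ + P / 2 ⟩ ℚ.- A / suc M)
            - floor (⟨ - (+ P) / 6 ⟩ ℚ.+ A / suc M)
            - floor (⟨ - (+ 5 * + P) / 6 ⟩ ℚ.+ A / suc M)

module _ {M : ℕ} (A : ℤ) where

  J J′ : ℤ
  J  = (+ 6 * A) ℤ./ + suc M
  J′ = (- (+ 6 * A)) ℤ./ + suc M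

  J′≡-J+[-s/N] : J′ ≡ - J + (- + ((+ 6 * A) % + suc M)) ℤ./ + suc M
  J′≡-J+[-s/N] = trans (/-shift (- + s) (- J) (trans (cong -_ 6A≡s+J*N) (negate (+ s) J (+ suc M))))
                       (ℤP.+-comm _ (- J))
    where
    s : ℕ
    s = (+ 6 * A) % + suc M
    6A≡s+J*N : + 6 * A ≡ + s + J * + suc M
    6A≡s+J*N = a≡a%n+[a/n]*n (+ 6 * A) (+ suc M)
    negate : ∀ s J N → - (s + J * N) ≡ - s + - J * N
    negate = solve-∀

  lhs≡lhsᴶ : lhs M A ≡ lhsᴶ J J′
  lhs≡lhsᴶ =
    cong₂ _-_ (cong₂ _-_ (cong₂ _+_ (trans (floor-/ (+ 3 * A) M) (/-scale 1 (e₁ A)))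
                                    (cong (+ 3 *_) (trans (floor-/ (- A) M) (/-scale 5 (e₂ A)))))
                         (cong (+ 3 *_) (trans (floor-/ (- (+ 2) * A) M) (/-scale 2 (e₃ A)))))
              (floor-/ (+ 6 * A) M)
    where
    e₁ : ∀ A → + 2 * (+ 3 * A) ≡ + 6 * A
    e₁ = solve-∀
    e₂ : ∀ A → + 6 * - A ≡ - (+ 6 * A)
    e₂ = solve-∀
    e₃ : ∀ A → + 3 * (- + 2 * A) ≡ - (+ 6 * A)
    e₃ = solve-∀

  floor[1/2-t] : (+ 1 * + suc M + - A * + 2) ℤ./ + (2 ℕ.* suc M) ≡ (J′ + + 3) ℤ./ + 6
  floor[1/2-t] = begin
    x ℤ./ + (2 ℕ.* suc M)               ≡⟨ /-cong x (+ 3 * x) cross ⟨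
    (+ 3 * x) ℤ./ + (6 ℕ.* suc M)       ≡⟨ n/[c*b]≡n/b/c (+ 3 * x) ⟩
    ((+ 3 * x) ℤ./ + suc M) ℤ./ + 6     ≡⟨ cong (ℤ._/ + 6) (/-shift (- (+ 6 * A)) (+ 3) (e₂ A (+ suc M))) ⟩
    (J′ + + 3) ℤ./ + 6                  ∎
    where
    open ≡-Reasoning
    x : ℤ
    x = + 1 * + suc M + - A * + 2
    e₁ : ∀ x N → x * (+ 6 * N) ≡ + 3 * x * (+ 2 * N)
    e₁ = solve-∀
    cross : x * + (6 ℕ.* suc M) ≡ + 3 * x * + (2 ℕ.* suc M)
    cross = trans (cong (x *_) (ℤP.pos-* 6 (suc M)))
                  (trans (e₁ x (+ suc M)) (cong (λ y → + 3 * x * y) (sym (ℤP.pos-* 2 (suc M)))))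
    e₂ : ∀ A N → + 3 * (+ 1 * N + - A * + 2) ≡ - (+ 6 * A) + + 3 * N
    e₂ = solve-∀

  floor[c/6+t] : ∀ n {c} → n % + 6 ≡ c → floor (⟨ n / 6 ⟩ ℚ.+ A / suc M) ≡ (J + + c) ℤ./ + 6
  floor[c/6+t] n refl = begin
    floor (⟨ n / 6 ⟩ ℚ.+ A / suc M)                        ≡⟨ floor[⟨n/d⟩+z/m] n 5 A M ⟩
    (+ c * + suc M + A * + 6) ℤ./ + (6 ℕ.* suc M)          ≡⟨ n/[c*b]≡n/b/c (+ c * + suc M + A * + 6) ⟩
    ((+ c * + suc M + A * + 6) ℤ./ + suc M) ℤ./ + 6        ≡⟨ cong (ℤ._/ + 6) (/-shift (+ 6 * A) (+ c) (e (+ c) A (+ suc M))) ⟩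
    (J + + c) ℤ./ + 6                                      ∎
    where
    open ≡-Reasoning
    c : ℕ
    c = n % + 6
    e : ∀ c A N → c * N + A * + 6 ≡ + 6 * A + c * N
    e = solve-∀

  rhs≡rhsᴶ : ∀ P {c₁ c₂} → + P % + 2 ≡ 1 → (- + P) % + 6 ≡ c₁ → (- (+ 5 * + P)) % + 6 ≡ c₂ →
             rhs M A P ≡ rhsᴶ J J′ c₁ c₂
  rhs≡rhsᴶ P P%2≡1 -P%6≡c₁ -5P%6≡c₂ =
    cong₂ _-_ (cong₂ _-_ (cong (- + 2 *_) (begin
                            floor (⟨ + P / 2 ⟩ ℚ.- A / suc M)
                              ≡⟨ floor[⟨n/d⟩-z/m] (+ P) 1 A M ⟩
                            (+ (+ P % + 2) * + suc M + - A * + 2) ℤ./ + (2 ℕ.* suc M)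
                              ≡⟨ cong (λ r → (+ r * + suc M + - A * + 2) ℤ./ + (2 ℕ.* suc M)) P%2≡1 ⟩
                            (+ 1 * + suc M + - A * + 2) ℤ./ + (2 ℕ.* suc M)
                              ≡⟨ floor[1/2-t] ⟩
                            (J′ + + 3) ℤ./ + 6 ∎))
                         (floor[c/6+t] (- + P) -P%6≡c₁))
              (floor[c/6+t] (- (+ 5 * + P)) -5P%6≡c₂)
    where open ≡-Reasoning

+[a+u*6] : ∀ a u → + (a ℕ.+ u ℕ.* 6) ≡ + a + + u * + 6
+[a+u*6] a u = trans (ℤP.pos-+ a (u ℕ.* 6)) (cong (λ x → + a + x) (ℤP.pos-* u 6))

lhs≡rhs : ∀ M A P → (∃[ u ] P ≡ 1 ℕ.+ u ℕ.* 6) ⊎ (∃[ u ] P ≡ 5 ℕ.+ u ℕ.* 6) →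
          ((+ 6 * A) % + suc M ≡ 0 → J {M} A % + 6 ≢ 3) → lhs M A ≡ rhs M A P
lhs≡rhs M A P P≡1∨5 J≢3 = begin
  lhs M A                              ≡⟨ lhs≡lhsᴶ A ⟩
  lhsᴶ (J A) (J′ A)                    ≡⟨ lhsᴶ≡rhsᴶ (J A) (J′ A) _ (n%d<d (+ 6 * A) (+ suc M)) (J′≡-J+[-s/N] A) J≢3 ⟩
  rhsᴶ (J A) (J′ A) 1 5                ≡⟨ via-residues P≡1∨5 ⟨
  rhs M A P                            ∎
  where
  open ≡-Reasoning
  via-residues : (∃[ u ] P ≡ 1 ℕ.+ u ℕ.* 6) ⊎ (∃[ u ] P ≡ 5 ℕ.+ u ℕ.* 6) → rhs M A P ≡ rhsᴶ (J A) (J′ A) 1 5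
  via-residues (inj₁ (u , refl)) = trans
    (rhs≡rhsᴶ A P (%-unique (+ u * + 3) (trans P≡ (e₀ (+ u))) (s≤s (s≤s z≤n)))
                  (%-unique (- + u - + 1) (trans (cong -_ P≡) (e₁ (+ u))) (ℕP.n<1+n 5))
                  (%-unique (- (+ u * + 5) - + 1) (trans (cong (λ x → - (+ 5 * x)) P≡) (e₂ (+ u))) (s≤s (s≤s z≤n))))
    (rhsᴶ-swap (J A) (J′ A) 5 1)
    where
    P≡ : + (1 ℕ.+ u ℕ.* 6) ≡ + 1 + + u * + 6
    P≡ = +[a+u*6] 1 u
    e₀ : ∀ U → + 1 + U * + 6 ≡ + 1 + (U * + 3) * + 2
    e₀ = solve-∀
    e₁ : ∀ U → - (+ 1 + U * + 6) ≡ + 5 + (- U - + 1) * + 6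
    e₁ = solve-∀
    e₂ : ∀ U → - (+ 5 * (+ 1 + U * + 6)) ≡ + 1 + (- (U * + 5) - + 1) * + 6
    e₂ = solve-∀
  via-residues (inj₂ (u , refl)) =
    rhs≡rhsᴶ A P (%-unique (+ u * + 3 + + 2) (trans P≡ (e₀ (+ u))) (s≤s (s≤s z≤n)))
                 (%-unique (- + u - + 1) (trans (cong -_ P≡) (e₁ (+ u))) (s≤s (s≤s z≤n)))
                 (%-unique (- (+ u * + 5) - + 5) (trans (cong (λ x → - (+ 5 * x)) P≡) (e₂ (+ u))) (ℕP.n<1+n 5))
    where
    P≡ : + (5 ℕ.+ u ℕ.* 6) ≡ + 5 + + u * + 6
    P≡ = +[a+u*6] 5 u
    e₀ : ∀ U → + 5 + U * + 6 ≡ + 1 + (U * + 3 + + 2) * + 2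
    e₀ = solve-∀
    e₁ : ∀ U → - (+ 5 + U * + 6) ≡ + 1 + (- U - + 1) * + 6
    e₁ = solve-∀
    e₂ : ∀ U → - (+ 5 * (+ 5 + U * + 6)) ≡ + 5 + (- (U * + 5) - + 5) * + 6
    e₂ = solve-∀

-- Arithmetic of p^i and q − 1

prime∣m^i⇒prime∣m : ∀ {d} m i → Prime d → d ∣ m ^ i → d ∣ m
prime∣m^i⇒prime∣m m zero    d-prime d∣1 = ⊥-elim (¬prime[1] (subst Prime (∣1⇒≡1 d∣1) d-prime))
prime∣m^i⇒prime∣m m (suc i) d-prime d∣m*m^i with euclidsLemma m (m ^ i) d-prime d∣m*m^i
... | inj₁ d∣m   = d∣m
... | inj₂ d∣m^i = prime∣m^i⇒prime∣m m i d-prime d∣m^i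

prime<p⇒∤p^i : ∀ {d p} i → Prime d → Prime p → d < p → ¬ d ∣ p ^ i
prime<p⇒∤p^i {d} {p} i d-prime p-prime d<p d∣p^i with prime⇒irreducible p-prime (prime∣m^i⇒prime∣m p i d-prime d∣p^i)
... | inj₁ d≡1 = ¬prime[1] (subst Prime d≡1 d-prime)
... | inj₂ d≡p = ℕP.<⇒≢ d<p d≡p

prime[3] : Prime 3
prime[3] = toWitness {a? = prime? 3} tt

∤2∧∤3⇒≡1∨5[mod6] : ∀ n → ¬ 2 ∣ n → ¬ 3 ∣ n → (∃[ u ] n ≡ 1 ℕ.+ u ℕ.* 6) ⊎ (∃[ u ] n ≡ 5 ℕ.+ u ℕ.* 6)
∤2∧∤3⇒≡1∨5[mod6] n 2∤n 3∤n = by-residue (n ℕ.% 6) (m≡m%n+[m/n]*n n 6) (m%n<n n 6)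
  where
  u : ℕ
  u = n ℕ./ 6
  by-residue : ∀ r → n ≡ r ℕ.+ u ℕ.* 6 → r < 6 → (∃[ u ] n ≡ 1 ℕ.+ u ℕ.* 6) ⊎ (∃[ u ] n ≡ 5 ℕ.+ u ℕ.* 6)
  by-residue 0 n≡ _ = contradiction (divides (u ℕ.* 3) (trans n≡ (e₀ u))) 2∤n
    where e₀ : ∀ u → 0 ℕ.+ u ℕ.* 6 ≡ u ℕ.* 3 ℕ.* 2
          e₀ = ℕ-Ring.solve-∀
  by-residue 1 n≡ _ = inj₁ (u , n≡)
  by-residue 2 n≡ _ = contradiction (divides (1 ℕ.+ u ℕ.* 3) (trans n≡ (e₂ u))) 2∤n
    where e₂ : ∀ u → 2 ℕ.+ u ℕ.* 6 ≡ (1 ℕ.+ u ℕ.* 3) ℕ.* 2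
          e₂ = ℕ-Ring.solve-∀
  by-residue 3 n≡ _ = contradiction (divides (1 ℕ.+ u ℕ.* 2) (trans n≡ (e₃ u))) 3∤n
    where e₃ : ∀ u → 3 ℕ.+ u ℕ.* 6 ≡ (1 ℕ.+ u ℕ.* 2) ℕ.* 3
          e₃ = ℕ-Ring.solve-∀
  by-residue 4 n≡ _ = contradiction (divides (2 ℕ.+ u ℕ.* 3) (trans n≡ (e₄ u))) 2∤n
    where e₄ : ∀ u → 4 ℕ.+ u ℕ.* 6 ≡ (2 ℕ.+ u ℕ.* 3) ℕ.* 2
          e₄ = ℕ-Ring.solve-∀
  by-residue 5 n≡ _ = inj₂ (u , n≡)
  by-residue (suc (suc (suc (suc (suc (suc _)))))) _ (s≤s (s≤s (s≤s (s≤s (s≤s (s≤s ()))))))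

m^i∣m^j : ∀ m {i j} → i ≤ j → m ^ i ∣ m ^ j
m^i∣m^j m {i} {j} i≤j = divides (m ^ (j ∸ i)) (begin
  m ^ j                  ≡⟨ cong (m ^_) (ℕP.m+[n∸m]≡n i≤j) ⟨
  m ^ (i ℕ.+ (j ∸ i))    ≡⟨ ℕP.^-distribˡ-+-* m i (j ∸ i) ⟩
  m ^ i ℕ.* m ^ (j ∸ i)  ≡⟨ ℕP.*-comm (m ^ i) (m ^ (j ∸ i)) ⟩
  m ^ (j ∸ i) ℕ.* m ^ i  ∎)
  where open ≡-Reasoning

∣suc⇒coprime : ∀ {m n} → n ∣ suc m → Coprime m n
∣suc⇒coprime {m} n∣1+m {d} (d∣m , d∣n) =
  ∣1⇒≡1 (∣m+n∣m⇒∣n (subst (d ∣_) (ℕP.+-comm 1 m) (∣-trans d∣n n∣1+m)) d∣m)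

N∣6x∧[6x/N]%6≡3⇒N∣2x : ∀ x N .{{_ : ℕ.NonZero N}} →
                        (6 ℕ.* x) ℕ.% N ≡ 0 → (6 ℕ.* x ℕ./ N) ℕ.% 6 ≡ 3 → N ∣ 2 ℕ.* x
N∣6x∧[6x/N]%6≡3⇒N∣2x x N N∣6x J%6≡3 = divides (1 ℕ.+ u ℕ.* 2) (ℕP.*-cancelˡ-≡ (2 ℕ.* x) _ 3 (begin
  3 ℕ.* (2 ℕ.* x)                ≡⟨ ℕP.*-assoc 3 2 x ⟨
  6 ℕ.* x                        ≡⟨ m≡m%n+[m/n]*n (6 ℕ.* x) N ⟩
  (6 ℕ.* x) ℕ.% N ℕ.+ j ℕ.* N    ≡⟨ cong (λ r → r ℕ.+ j ℕ.* N) N∣6x ⟩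
  j ℕ.* N                        ≡⟨ cong (ℕ._* N) (m≡m%n+[m/n]*n j 6) ⟩
  (j ℕ.% 6 ℕ.+ u ℕ.* 6) ℕ.* N    ≡⟨ cong (λ r → (r ℕ.+ u ℕ.* 6) ℕ.* N) J%6≡3 ⟩
  (3 ℕ.+ u ℕ.* 6) ℕ.* N          ≡⟨ factor u N ⟩
  3 ℕ.* ((1 ℕ.+ u ℕ.* 2) ℕ.* N)  ∎))
  where
  open ≡-Reasoning
  j : ℕ
  j = 6 ℕ.* x ℕ./ N
  u : ℕ
  u = j ℕ./ 6
  factor : ∀ u N → (3 ℕ.+ u ℕ.* 6) ℕ.* N ≡ 3 ℕ.* ((1 ℕ.+ u ℕ.* 2) ℕ.* N)
  factor = ℕ-Ring.solve-∀

∣∧<2*⇒≡ : ∀ {m n} → n ∣ m → 0 < m → m < 2 ℕ.* n → m ≡ n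
∣∧<2*⇒≡ (divides zero m≡0) 0<m _ = contradiction m≡0 (ℕP.>⇒≢ 0<m)
∣∧<2*⇒≡ {n = n} (divides 1 m≡n+0) _ _ = trans m≡n+0 (ℕP.+-identityʳ n)
∣∧<2*⇒≡ {n = n} (divides (suc (suc k)) refl) _ m<2n =
  contradiction m<2n (ℕP.≤⇒≯ (ℕP.*-monoˡ-≤ n {2} {suc (suc k)} (s≤s (s≤s z≤n))))

J≡3[mod6]⇒2l≡N : ∀ {M} l P → 0 < l → l ≤ M → P ∣ suc (suc M) →
                 (+ 6 * + (l ℕ.* P)) % + suc M ≡ 0 → J {M} (+ (l ℕ.* P)) % + 6 ≡ 3 → 2 ℕ.* l ≡ suc M
J≡3[mod6]⇒2l≡N {M} l P 0<l l≤M P∣N+1 N∣6A J%6≡3 =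
  ∣∧<2*⇒≡ N∣2l (ℕP.≤-trans (s≤s z≤n) (ℕP.*-monoʳ-≤ 2 0<l)) (ℕP.*-monoʳ-< 2 (s≤s l≤M))
  where
  x : ℕ
  x = l ℕ.* P
  6A≡6x : + 6 * + x ≡ + (6 ℕ.* x)
  6A≡6x = sym (ℤP.pos-* 6 x)
  N∣2x : suc M ∣ 2 ℕ.* x
  N∣2x = N∣6x∧[6x/N]%6≡3⇒N∣2x x (suc M)
    (subst (λ y → y % + suc M ≡ 0) 6A≡6x N∣6A)
    (subst (λ y → y % + 6 ≡ 3) (trans (cong (ℤ._/ + suc M) 6A≡6x) (div-pos-is-/ℕ (+ (6 ℕ.* x)) (suc M))) J%6≡3)
  rearrange : ∀ l P → 2 ℕ.* (l ℕ.* P) ≡ P ℕ.* (2 ℕ.* l)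
  rearrange = ℕ-Ring.solve-∀
  N∣2l : suc M ∣ 2 ℕ.* l
  N∣2l = coprime-divisor (∣suc⇒coprime P∣N+1) (subst (suc M ∣_) (rearrange l P) N∣2x)

∸1≡suc[∸2] : ∀ {n} → 1 < n → n ∸ 1 ≡ suc (n ∸ 2)
∸1≡suc[∸2] {suc zero}    (s≤s ())
∸1≡suc[∸2] {suc (suc n)} _ = refl

lemma3p2 : ∀ (p r l i : ℕ) → Prime p → 3 < p → 1 ≤ r →
             1 ≤ l → l ≤ (p ^ r) ∸ 2 → (+ 2) ℤ.* (+ l) ≢ (+ (p ^ r)) ℤ.- (+ 1) →
             i ≤ r ∸ 1 →
             let q = p ^ r
                 a = + (l ℕ.* p ^ i)
                 t = a // (q ∸ 1)
             in floor (((+ 3) ℤ.* a) // (q ∸ 1)) ℤ.+ (+ 3) ℤ.* floor ((ℤ.- a) // (q ∸ 1))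
                ℤ.- (+ 3) ℤ.* floor (((ℤ.- (+ 2)) ℤ.* a) // (q ∸ 1)) ℤ.- floor (((+ 6) ℤ.* a) // (q ∸ 1))
                ≡ (ℤ.- (+ 2)) ℤ.* floor (⟨ (+ (p ^ i)) // 2 ⟩ ℚ.- t)
                  ℤ.- floor (⟨ (ℤ.- (+ (p ^ i))) // 6 ⟩ ℚ.+ t)
                  ℤ.- floor (⟨ (ℤ.- ((+ 5) ℤ.* (+ (p ^ i)))) // 6 ⟩ ℚ.+ t)
lemma3p2 p r l i p-prime 3<p 1≤r 1≤l l≤q∸2 2l≢q-1 i≤r∸1
  -- once q ∸ 1 is a successor, every _//_ in the goal computes to _/_
  rewrite ∸1≡suc[∸2] (ℕP.^-monoʳ-< p (ℕP.<-trans (s≤s (s≤s z≤n)) 3<p) 1≤r) =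
  lhs≡rhs M (+ (l ℕ.* P)) P P≡±1[mod6] J%6≢3
  where
  1<p : 1 < p
  1<p = ℕP.<-trans (s≤s (s≤s z≤n)) 3<p
  M : ℕ
  M = p ^ r ∸ 2
  P : ℕ
  P = p ^ i
  q≡2+M : p ^ r ≡ suc (suc M)
  q≡2+M = sym (ℕP.m+[n∸m]≡n (ℕP.^-monoʳ-< p 1<p 1≤r))
  P≡±1[mod6] : (∃[ u ] P ≡ 1 ℕ.+ u ℕ.* 6) ⊎ (∃[ u ] P ≡ 5 ℕ.+ u ℕ.* 6)
  P≡±1[mod6] = ∤2∧∤3⇒≡1∨5[mod6] P (prime<p⇒∤p^i i prime[2] p-prime (ℕP.<-trans (ℕP.n<1+n 2) 3<p))
                                   (prime<p⇒∤p^i i prime[3] p-prime 3<p)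
  P∣q : P ∣ suc (suc M)
  P∣q = subst (P ∣_) q≡2+M (m^i∣m^j p (ℕP.≤-trans i≤r∸1 (ℕP.m∸n≤m r 1)))
  J%6≢3 : (+ 6 * + (l ℕ.* P)) % + suc M ≡ 0 → J {M} (+ (l ℕ.* P)) % + 6 ≢ 3
  J%6≢3 N∣6A J%6≡3 = 2l≢q-1 (begin
    + 2 * + l          ≡⟨ ℤP.pos-* 2 l ⟨
    + (2 ℕ.* l)        ≡⟨ cong +_ (J≡3[mod6]⇒2l≡N l P 1≤l l≤q∸2 P∣q N∣6A J%6≡3) ⟩
    + suc M            ≡⟨ cong (λ n → + n - + 1) q≡2+M ⟨
    + p ^ r - + 1      ∎)
    where open ≡-Reasoning
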